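{- Let $k\ge1$ and $n\ge k+1$. The sphere $\Lambda^{2k-1}_{2n-1}=\mathrm{lk}(\{1,2\},\Delta^{2k+1}_{2n+1})$ contains a subcomplex isomorphic to the ball $\mathcal{B}(F(2k,n))$. Consequently, every squeezed $(2k-1)$-ball with at most $n$ vertices is isomorphic to a subcomplex of $\Lambda^{2k-1}_{2n-1}$, and hence also to a subcomplex of $\Delta^{2k+1}_{2n+1}$.
   Context: Simplicial complexes are finite abstract simplicial complexes; $\overline{A}$ is the simplex of all subsets of a finite set $A$. $V_m=\{\pm1,\dots,\pm m\}$; $-\sigma=\{ -v:v\in\sigma\}$, $-\Gamma=\{ -\sigma:\sigma\in\Gamma\}$. The join is $\Gamma*\Gamma'=\{\sigma\cup\tau\}$, $\Gamma*v:=\Gamma*\overline{\{v\}}$; a path/cycle $(v_1,\dots,v_m)$ is the 1-dimensional complex with edges $\{v_j,v_{j+1}\}$. $\partial C^*_m$ is the complex of all subsets of $V_m$ with no pair $\{j,-j\}$. For pure $\Delta$ and pure full-dimensional subcomplex $\Gamma$, $\Delta\setminus\Gamma$ is generated by facets of $\Delta$ not in $\Gamma$; $\partial B$ is the boundary of a combinatorial ball $B$; $\mathrm{lk}(\tau,\Delta)=\{\sigma\in\Delta:\sigma\cap\tau=\emptyset,\sigma\cup\tau\in\Delta\}$. Recursive definition: $\Delta^1_n=(1,\dots,n,-1,\dots,-n,1)$; $\Delta^d_{d+1}=\partial C^*_{d+1}$; $B^{d,j}_n=\emptyset$ for $j<0$; $B^{1,0}_n=\overline{\{ -1,n\}}$;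 $B^{2k-1,k}_n=\Delta^{2k-1}_n\setminus B^{2k-1,k-1}_n$ ($k\ge1$, $n\ge 2k$); $B^{d,i}_n=(B^{d-1,i}_{n-1}*n)\cup((-B^{d-1,i-1}_{n-1})*(-n))$ ($d\ge2$, $n\ge d+1$, $i\le\lfloor d/2\rfloor$); $\Delta^d_{n+1}$ is obtained from $\Delta^d_n$ by replacing $B=B^{d,\lceil d/2\rceil-1}_n$ with $\partial B*(n+1)$ and $-B$ with $\partial(-B)*(-n-1)$. $F(2k,n)$ is the collection of subsets of $[n]$ of the form $\{i_1,i_1+1\}\cup\{i_2,i_2+1\}\cup\dots\cup\{i_k,i_k+1\}$ with $i_1\ge1$, $i_k<n$ and $i_{m+1}\ge i_m+2$ for all $m$; for $\mathcal{F}\subseteq F(2k,n)$, $\mathcal{B}(\mathcal{F})$ is the complex generated by the sets in $\mathcal{F}$. Partially order $F(2k,n)$ by $\{a_1<\dots<a_{2k}\}\le\{b_1<\dots<b_{2k}\}$ iff $a_j\le b_j$ for all $j$. A squeezed $(2k-1)$-ball (Kalai) with at most $n$ vertices is a complex $\mathcal{B}(\mathcal{F})$ where $\mathcal{F}$ is a nonempty initial set (down-closed subset) of $F(2k,m)$ for some $m\le n$. -}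

module Defs where

open import Data.Bool using (Bool; true; false; not; _∧_; if_then_else_)
open import Data.Nat using (ℕ; zero; suc; _+_; _*_; _∸_; _≤_; _<_; _≡ᵇ_; _<ᵇ_; ⌊_/2⌋; ⌈_/2⌉)
open import Data.Integer using (ℤ; +_; -_)
import Data.Integer as ℤ
open import Data.List using (List; []; _∷_; _++_; map; concatMap; filterᵇ; applyUpTo; length)
open import Data.Bool.ListAction using (and; or)
open import Data.List.Membership.Propositional using (_∈_; _∉_)
open import Data.List.Relation.Binary.Subset.Propositional using (_⊆_)
open import Data.List.Relation.Binary.Pointwise using (Pointwise)
open import Data.List.Relation.Unary.Any using (Any)
open import Data.Product using (Σ; _×_)
open import Data.Unit using (⊤)
open import Relation.Nullary.Decidable using (⌊_⌋)
open import Relation.Binary.PropositionalEquality using (_≡_)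

-- Faces are finite sets of vertices represented as lists (order and
-- repetition irrelevant: membership is what counts).  A pure complex
-- is represented by a list of generating facets.

Face : Set
Face = List ℤ

Cx : Set
Cx = List Face

anyB : {A : Set} → (A → Bool) → List A → Bool
anyB p xs = or (map p xs)

allB : {A : Set} → (A → Bool) → List A → Bool
allB p xs = and (map p xs)

memb : ℤ → Face → Bool
memb x = anyB (λ y → ⌊ x ℤ.≟ y ⌋)

subb : Face → Face → Bool
subb σ τ = allB (λ x → memb x τ) σ

seteq : Face → Face → Bool
seteq σ τ = subb σ τ ∧ subb τ σ

inC : Face → Cx → Bool
inC σ C = anyB (subb σ) C

neg : Face → Face
neg = map (-_)

negC : Cx → Cx
negC = map neg

coneC : Cx → ℤ → Cx
coneC C v = map (v ∷_) C

minusC : Cx → Cx → Cx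
minusC D G = filterᵇ (λ F → not (inC F G)) D

removeV : ℤ → Face → Face
removeV v = filterᵇ (λ w → not ⌊ w ℤ.≟ v ⌋)

ridges : Cx → Cx
ridges C = concatMap (λ F → map (λ v → removeV v F) F) C

-- r lies in exactly one facet of C (facets compared as sets)
uniqueFacet : Face → Cx → Bool
uniqueFacet r C with filterᵇ (subb r) C
... | []     = false
... | F ∷ Fs = allB (seteq F) Fs

-- boundary of a combinatorial ball: generated by the ridges lying in
-- exactly one facet
bdC : Cx → Cx
bdC C = filterᵇ (λ r → uniqueFacet r C) (ridges C)

pv : ℕ → ℤ
pv j = + j

nv : ℕ → ℤ
nv j = - (+ j)

pathEdges : List ℤ → Cx
pathEdges (x ∷ y ∷ rest) = (x ∷ y ∷ []) ∷ pathEdges (y ∷ rest)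
pathEdges _ = []

Δ1 : ℕ → Cx
Δ1 n = pathEdges (applyUpTo (λ i → pv (suc i)) n ++ applyUpTo (λ i → nv (suc i)) n ++ (pv 1 ∷ []))

B1 : ℕ → ℕ → Cx
B1 zero n = (nv 1 ∷ pv n ∷ []) ∷ []
B1 (suc zero) n = minusC (Δ1 n) (B1 zero n)
B1 (suc (suc _)) n = []

-- ∂C*_m : facets are the sign choices {±1,…,±m}
cross : ℕ → Cx
cross zero = [] ∷ []
cross (suc m) = map (pv (suc m) ∷_) (cross m) ++ map (nv (suc m) ∷_) (cross m)

-- B^{d,i}_n = (B^{d-1,i}_{n-1} * n) ∪ ((-B^{d-1,i-1}_{n-1}) * (-n)),
-- given the family Bp = B^{d-1,·}_· (B^{d-1,-1} = ∅)
Bjoin : (ℕ → ℕ → Cx) → ℕ → ℕ → Cx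
Bjoin Bp i zero = []
Bjoin Bp zero (suc n) = coneC (Bp zero n) (pv (suc n))
Bjoin Bp (suc i) (suc n) =
  coneC (Bp (suc i) n) (pv (suc n)) ++ coneC (negC (Bp i n)) (nv (suc n))

replace : Cx → Cx → ℕ → Cx
replace D B v =
  minusC (minusC D B) (negC B) ++ coneC (bdC B) (pv v) ++ coneC (bdC (negC B)) (nv v)

-- Δ^d_n for d ≥ 2, given Bc n = B^{d,⌈d/2⌉-1}_n
-- (junk value [] for n < d+1, where Δ^d_n is undefined)
Δrec : ℕ → (ℕ → Cx) → ℕ → Cx
Δrec d Bc zero = []
Δrec d Bc (suc n) =
  if n <ᵇ d then []
  else if n ≡ᵇ d then cross (suc d)
  else replace (Δrec d Bc n) (Bc n) (suc n)

record Level : Set where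
  field
    Δl : ℕ → Cx
    Bl : ℕ → ℕ → Cx

isOdd : ℕ → Bool
isOdd d = not (⌊ d /2⌋ ≡ᵇ ⌈ d /2⌉)

step : ℕ → Level → Level
step d prev = record { Δl = Δd ; Bl = Bd }
  where
  Bj : ℕ → ℕ → Cx
  Bj = Bjoin (Level.Bl prev)
  Δd : ℕ → Cx
  Δd = Δrec d (Bj (⌈ d /2⌉ ∸ 1))
  -- B^{2k-1,k}_n = Δ^{2k-1}_n \ B^{2k-1,k-1}_n (top index, d odd)
  Bd : ℕ → ℕ → Cx
  Bd i n = if isOdd d ∧ (i ≡ᵇ ⌈ d /2⌉) then minusC (Δd n) (Bj (i ∸ 1) n) else Bj i n

level : ℕ → Level
level zero = record { Δl = λ _ → [] ; Bl = λ _ _ → [] }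
level (suc zero) = record { Δl = Δ1 ; Bl = B1 }
level (suc (suc d')) = step (suc (suc d')) (level (suc d'))

Δ : ℕ → ℕ → Cx
Δ d = Level.Δl (level d)

B : ℕ → ℕ → ℕ → Cx
B d = Level.Bl (level d)

IsFace : Cx → Face → Set
IsFace C σ = Any (σ ⊆_) C

Lk : Face → (Face → Set) → Face → Set
Lk τ K σ = (∀ {v} → v ∈ σ → v ∉ τ) × K (σ ++ τ)

Λ : ℕ → ℕ → Face → Set
Λ k n = Lk (pv 1 ∷ pv 2 ∷ []) (IsFace (Δ (2 * k + 1) (2 * n + 1)))

pairs : List ℕ → List ℕ
pairs [] = []
pairs (i ∷ is) = i ∷ suc i ∷ pairs is

Adm : ℕ → ℕ → List ℕ → Set
Adm lo n [] = ⊤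
Adm lo n (i ∷ is) = lo ≤ i × i < n × Adm (suc (suc i)) n is

InF : ℕ → ℕ → List ℕ → Set
InF k n σ = Σ (List ℕ) λ is → length is ≡ k × Adm 1 n is × σ ≡ pairs is

-- the partial order {a_1<…<a_2k} ≤ {b_1<…<b_2k} (lists are increasing)
_≼_ : List ℕ → List ℕ → Set
σ ≼ τ = Pointwise _≤_ σ τ

Gen : (List ℕ → Set) → List ℕ → Set
Gen P σ = Σ (List ℕ) λ τ → P τ × σ ⊆ τ

NonemptyInitial : ℕ → ℕ → (List ℕ → Set) → Set
NonemptyInitial k m P =
  (Σ (List ℕ) P) ×
  (∀ σ → P σ → InF k m σ) ×
  (∀ σ τ → InF k m σ → InF k m τ → σ ≼ τ → P τ → P σ)

IsoSub : (List ℕ → Set) → (Face → Set) → Set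
IsoSub A K = Σ (ℕ → ℤ) λ f →
  (∀ x y → A (x ∷ []) → A (y ∷ []) → f x ≡ f y → x ≡ y) ×
  (∀ σ → A σ → K (map f σ))

-- Put jₘ = n − iₘ for a generator {i₁, i₁ + 1, …, i_k, i_k + 1} of F(2k, n). The map j ↦ 2(n − j) + 3 sends it
-- to ⋃ₘ {2jₘ + 1, 2jₘ + 3}, a face of Λ^{2k−1}_{2n−1} because {1, 2} ∪ ⋃ₘ {2jₘ + 1, 2jₘ + 3} is a facet of
-- Δ^{2k+1}_N for every N ≥ 2j₁ + 3.
--
-- That is shown by induction on k, adding the pair with the largest j. Let r be such a facet of Δ^{2k−1}_{m+1},
-- with positive vertices, none above m + 1 (none above m when k ≥ 2). Every facet of B^{2k−1,k−1}_{m+1} contains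
-- ±(m + 1), so r lies in the complementary ball B^{2k−1,k}_{m+1}. Coning twice puts r ∪ {m + 2, m + 3} into
-- B^{2k+1,k}_{m+3}, where r ∪ {m + 2} is a boundary ridge: the other half of that ball, the cone over
-- −B^{2k,k−1}_{m+2}, has no face containing it. Hence r ∪ {m + 2, m + 4} is a facet of Δ^{2k+1}_{m+4}, and it
-- survives every later replacement, since each facet of the replaced balls has a vertex ±N or ±(m + 3) outside it.
-- Every "not contained in" step is a count: a facet containing a duplicate-free face with at least as many
-- vertices has no other vertex.

module Submission where

open import Defs
open import Data.Bool using (Bool; true; false; not; T; _∧_)
open import Data.Bool.Properties using (T-∧)
open import Data.Nat
  using (ℕ; zero; suc; _+_; _*_; _∸_; _≤_; _<_; _≤′_; ≤′-refl; ≤′-step; z≤n; s≤s; _≡ᵇ_; _<ᵇ_; ⌈_/2⌉)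
open import Data.Nat.Properties
  using (≤-refl; ≤-reflexive; ≤-trans; <⇒≤; n≤1+n; ≤-pred; <-irrefl; <-asym; m≤n⇒m<n∨m≡n; ≤′⇒≤; ≤⇒≤′
        ; suc-injective; +-suc; m≤n+m; m<n⇒0<n∸m; ∸-monoʳ-<; ∸-cancelˡ-≡; <ᵇ⇒<; ≡ᵇ⇒≡; ≡⇒≡ᵇ)
open import Data.Integer using (ℤ; -_)
import Data.Integer as ℤ
open import Data.Integer.Properties using (+-injective; neg-involutive)
open import Data.List using (List; []; _∷_; _++_; map; filterᵇ; length)
open import Data.List.Properties using (length-map; length-++-sucʳ; filter-notAll)
open import Data.List.Membership.Propositional using (_∈_; _∉_; find; lose)
open import Data.List.Membership.Propositional.Properties
  using (∈-map⁺; ∈-map⁻; ∈-++⁺ˡ; ∈-++⁺ʳ; ∈-++⁻; ∈-∃++; ∈-filter⁺; ∈-filter⁻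
        ; ∈-concatMap⁺; ∈-concatMap⁻)
import Data.List.Membership.DecPropositional as DecMembership
open import Data.List.Relation.Binary.Subset.Propositional using (_⊆_)
open import Data.List.Relation.Binary.Subset.Propositional.Properties using (⊆-trans; ∷⁺ʳ; ⊆∷∧∉⇒⊆)
open import Data.List.Relation.Unary.Any using (Any; here; there)
import Data.List.Relation.Unary.Any as Any
open import Data.List.Relation.Unary.Any.Properties using (any⁺; any⁻)
import Data.List.Relation.Unary.All as All
open import Data.List.Relation.Unary.All.Properties using (all⁺; all⁻)
open import Data.List.Relation.Unary.Unique.Propositional using (Unique)
import Data.List.Relation.Unary.AllPairs as AllPairs
open import Data.Product using (Σ; _×_; _,_; proj₁; proj₂)
open import Data.Sum using (_⊎_; inj₁; inj₂)
open import Data.Empty using (⊥-elim)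
open import Data.Unit using (⊤; tt)
open import Function using (_∘_)
open import Function.Bundles using (Equivalence)
open import Relation.Nullary using (¬_; yes; no)
open import Relation.Nullary.Decidable using (⌊_⌋; T?; toWitness; fromWitness)
open import Relation.Binary.PropositionalEquality using (_≡_; _≢_; refl; sym; trans; cong; subst; subst₂)

memb⁺ : ∀ {x F} → x ∈ F → T (memb x F)
memb⁺ {x} = any⁺ (λ y → ⌊ x ℤ.≟ y ⌋) ∘ Any.map fromWitness

memb⁻ : ∀ {x} F → T (memb x F) → x ∈ F
memb⁻ {x} F = Any.map toWitness ∘ any⁻ (λ y → ⌊ x ℤ.≟ y ⌋) F

subb⁺ : ∀ {σ τ} → σ ⊆ τ → T (subb σ τ)
subb⁺ {σ} {τ} σ⊆τ = all⁻ (λ x → memb x τ) (All.tabulate (memb⁺ ∘ σ⊆τ))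

subb⁻ : ∀ σ τ → T (subb σ τ) → σ ⊆ τ
subb⁻ σ τ t = memb⁻ τ ∘ All.lookup (all⁺ (λ x → memb x τ) σ t)

T-not : ∀ {b} → ¬ T b → T (not b)
T-not {true} ¬t = ¬t tt
T-not {false} _ = tt

T-not⁻ : ∀ {b} → T (not b) → ¬ T b
T-not⁻ {true} () _

∈-filterᵇ⁺ : {A : Set} (p : A → Bool) {xs : List A} {x : A} → x ∈ xs → T (p x) → x ∈ filterᵇ p xs
∈-filterᵇ⁺ p = ∈-filter⁺ (T? ∘ p)

∈-filterᵇ⁻ : {A : Set} (p : A → Bool) {xs : List A} {x : A} → x ∈ filterᵇ p xs → x ∈ xs × T (p x)
∈-filterᵇ⁻ p = ∈-filter⁻ (T? ∘ p)

seteq⁺ : ∀ {σ τ} → σ ⊆ τ → τ ⊆ σ → T (seteq σ τ)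
seteq⁺ σ⊆τ τ⊆σ = Equivalence.from T-∧ (subb⁺ σ⊆τ , subb⁺ τ⊆σ)

inC⁻ : ∀ σ C → T (inC σ C) → IsFace C σ
inC⁻ σ C = Any.map (subb⁻ σ _) ∘ any⁻ (subb σ) C

minusC⁺ : ∀ {D G F} → F ∈ D → ¬ IsFace G F → F ∈ minusC D G
minusC⁺ {G = G} {F} F∈D F∉G = ∈-filterᵇ⁺ (λ F → not (inC F G)) F∈D (T-not (F∉G ∘ inC⁻ F G))

minusC⁻ : ∀ {D G F} → F ∈ minusC D G → F ∈ D
minusC⁻ {G = G} = proj₁ ∘ ∈-filterᵇ⁻ (λ F → not (inC F G))

uniqueFacet⁺ : ∀ r C (S : Face) → IsFace C r →
  (∀ {H} → H ∈ C → r ⊆ H → H ⊆ S × S ⊆ H) → T (uniqueFacet r C)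
uniqueFacet⁺ r C S r∈C onlyS with filterᵇ (subb r) C in eq
... | [] with find r∈C
...   | H , H∈C , r⊆H with () ← subst (H ∈_) eq (∈-filterᵇ⁺ (subb r) H∈C (subb⁺ r⊆H))
uniqueFacet⁺ r C S r∈C onlyS | F ∷ Fs =
  all⁻ (seteq F) (All.tabulate λ H∈Fs →
    seteq⁺ (proj₂ (isS (there H∈Fs)) ∘ proj₁ (isS (here refl)))
           (proj₂ (isS (here refl)) ∘ proj₁ (isS (there H∈Fs))))
  where
  isS : ∀ {H} → H ∈ F ∷ Fs → H ⊆ S × S ⊆ H
  isS {H} H∈ with ∈-filterᵇ⁻ (subb r) (subst (H ∈_) (sym eq) H∈)
  ... | H∈C , r⊆H = onlyS H∈C (subb⁻ r H r⊆H)

removeV⁺ : ∀ v F {x} → x ∈ F → x ≢ v → x ∈ removeV v F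
removeV⁺ v F x∈F x≢v = ∈-filterᵇ⁺ _ x∈F (T-not (x≢v ∘ toWitness))

removeV⁻ : ∀ v F {x} → x ∈ removeV v F → x ∈ F
removeV⁻ v F = proj₁ ∘ ∈-filterᵇ⁻ _

length-removeV< : ∀ {v F} → v ∈ F → length (removeV v F) < length F
length-removeV< {v} {F} v∈F =
  filter-notAll (T? ∘ λ w → not ⌊ w ℤ.≟ v ⌋) F
    (Any.map (λ { refl t → T-not⁻ t (fromWitness refl) }) v∈F)

ridges⁺ : ∀ {C F v} → F ∈ C → v ∈ F → removeV v F ∈ ridges C
ridges⁺ F∈C v∈F = ∈-concatMap⁺ _ (Any.map (λ { refl → ∈-map⁺ _ v∈F }) F∈C)

ridges⁻ : ∀ C {r} → r ∈ ridges C → Σ Face λ F → F ∈ C × Σ ℤ λ v → v ∈ F × r ≡ removeV v F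
ridges⁻ C r∈ with find (∈-concatMap⁻ _ {xs = C} r∈)
... | F , F∈C , r∈F with ∈-map⁻ _ r∈F
...   | v , v∈F , refl = F , F∈C , v , v∈F , refl

bdC⁺ : ∀ {C r} → r ∈ ridges C → T (uniqueFacet r C) → r ∈ bdC C
bdC⁺ {C} = ∈-filterᵇ⁺ (λ r → uniqueFacet r C)

replace-keeps : ∀ {D B v F} → F ∈ D → ¬ IsFace B F → ¬ IsFace (negC B) F → F ∈ replace D B v
replace-keeps F∈D F∉B F∉-B = ∈-++⁺ˡ (minusC⁺ (minusC⁺ F∈D F∉B) F∉-B)

replace-cones : ∀ {D B v r} → r ∈ bdC B → (pv v ∷ r) ∈ replace D B v
replace-cones {D} {B} r∈∂B = ∈-++⁺ʳ (minusC (minusC D B) (negC B)) (∈-++⁺ˡ (∈-map⁺ _ r∈∂B))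

∈-neg⁺ : ∀ {x F} → x ∈ F → - x ∈ neg F
∈-neg⁺ = ∈-map⁺ -_

length-neg : ∀ F → length (neg F) ≡ length F
length-neg = length-map -_

Bjoin-facet : ∀ Bp i n {H} → H ∈ Bjoin Bp i (suc n) →
  (Σ Face λ G → G ∈ Bp i n × H ≡ pv (suc n) ∷ G) ⊎
  (Σ ℕ λ i′ → i ≡ suc i′ × Σ Face λ G → G ∈ Bp i′ n × H ≡ nv (suc n) ∷ neg G)
Bjoin-facet Bp zero n H∈ = inj₁ (∈-map⁻ _ H∈)
Bjoin-facet Bp (suc i) n H∈ with ∈-++⁻ (coneC (Bp (suc i) n) (pv (suc n))) H∈
... | inj₁ H∈+ = inj₁ (∈-map⁻ _ H∈+)
... | inj₂ H∈- with ∈-map⁻ _ H∈-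
...   | -G , -G∈ , refl with ∈-map⁻ neg -G∈
...     | G , G∈ , refl = inj₂ (i , refl , G , G∈ , refl)

Bjoin-cone⁺ : ∀ Bp i n {G} → G ∈ Bp i n → (pv (suc n) ∷ G) ∈ Bjoin Bp i (suc n)
Bjoin-cone⁺ Bp zero n G∈ = ∈-map⁺ _ G∈
Bjoin-cone⁺ Bp (suc i) n G∈ = ∈-++⁺ˡ (∈-map⁺ _ G∈)

Bjoin-apex : ∀ Bp i n {H} → H ∈ Bjoin Bp i (suc n) → pv (suc n) ∈ H ⊎ nv (suc n) ∈ H
Bjoin-apex Bp i n H∈ with Bjoin-facet Bp i n H∈
... | inj₁ (_ , _ , refl) = inj₁ (here refl)
... | inj₂ (_ , _ , _ , _ , refl) = inj₂ (here refl)

-- Pigeonhole for duplicate-free lists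

length-mono-⊆ : {A : Set} {xs ys : List A} → Unique xs → xs ⊆ ys → length xs ≤ length ys
length-mono-⊆ {xs = []} _ _ = z≤n
length-mono-⊆ {xs = x ∷ xs} (x∉xs AllPairs.∷ u) x∷xs⊆ys with ∈-∃++ (x∷xs⊆ys (here refl))
... | us , vs , refl = ≤-trans (s≤s (length-mono-⊆ u xs⊆us++vs)) (≤-reflexive (sym (length-++-sucʳ us x vs)))
  where
  xs⊆us++vs : xs ⊆ us ++ vs
  xs⊆us++vs {z} z∈xs with ∈-++⁻ us (x∷xs⊆ys (there z∈xs))
  ... | inj₁ z∈us = ∈-++⁺ˡ z∈us
  ... | inj₂ (here refl) = ⊥-elim (All.lookup x∉xs z∈xs refl)
  ... | inj₂ (there z∈vs) = ∈-++⁺ʳ us z∈vs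

⊆-by-length : {xs ys : List ℤ} → Unique xs → xs ⊆ ys → length ys ≤ length xs → ys ⊆ xs
⊆-by-length {xs} {ys} u xs⊆ys ys≤xs {y} y∈ys with DecMembership._∈?_ ℤ._≟_ y xs
... | yes y∈xs = y∈xs
... | no y∉xs = ⊥-elim (<-irrefl refl (≤-trans (length-mono-⊆ (y∉∷ AllPairs.∷ u) y∷xs⊆ys) ys≤xs))
  where
  y∉∷ : All.All (y ≢_) xs
  y∉∷ = All.tabulate λ { z∈xs refl → y∉xs z∈xs }
  y∷xs⊆ys : y ∷ xs ⊆ ys
  y∷xs⊆ys (here refl) = y∈ys
  y∷xs⊆ys (there z∈xs) = xs⊆ys z∈xs

Facets≤ : ℕ → Cx → Set
Facets≤ d C = ∀ {F} → F ∈ C → length F ≤ d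

minusC-Facets≤ : ∀ {d} D G → Facets≤ d D → Facets≤ d (minusC D G)
minusC-Facets≤ D G D≤ = D≤ ∘ minusC⁻ {D} {G}

negC-Facets≤ : ∀ {d C} → Facets≤ d C → Facets≤ d (negC C)
negC-Facets≤ C≤ F∈ with ∈-map⁻ neg F∈
... | G , G∈ , refl = subst (_≤ _) (sym (length-neg G)) (C≤ G∈)

coneC-Facets≤ : ∀ {d C v} → Facets≤ d C → Facets≤ (suc d) (coneC C v)
coneC-Facets≤ C≤ F∈ with ∈-map⁻ _ F∈
... | G , G∈ , refl = s≤s (C≤ G∈)

++-Facets≤ : ∀ {d} C C′ → Facets≤ d C → Facets≤ d C′ → Facets≤ d (C ++ C′)
++-Facets≤ C C′ C≤ C′≤ F∈ with ∈-++⁻ C F∈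
... | inj₁ F∈C = C≤ F∈C
... | inj₂ F∈C′ = C′≤ F∈C′

bdC-Facets≤ : ∀ {d} C → Facets≤ (suc d) C → Facets≤ d (bdC C)
bdC-Facets≤ C C≤ r∈ with ridges⁻ C (proj₁ (∈-filterᵇ⁻ (λ r → uniqueFacet r C) r∈))
... | F , F∈C , v , v∈F , refl = ≤-pred (≤-trans (length-removeV< v∈F) (C≤ F∈C))

replace-Facets≤ : ∀ {d} D B v → Facets≤ (suc d) D → Facets≤ (suc d) B → Facets≤ (suc d) (replace D B v)
replace-Facets≤ D B v D≤ B≤ =
  ++-Facets≤ _ _ (minusC-Facets≤ _ (negC B) (minusC-Facets≤ D B D≤))
    (++-Facets≤ _ _ (coneC-Facets≤ (bdC-Facets≤ B B≤))
                    (coneC-Facets≤ (bdC-Facets≤ (negC B) (negC-Facets≤ B≤))))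

cross-Facets≤ : ∀ m → Facets≤ m (cross m)
cross-Facets≤ zero (here refl) = z≤n
cross-Facets≤ (suc m) = ++-Facets≤ _ _ (coneC-Facets≤ (cross-Facets≤ m)) (coneC-Facets≤ (cross-Facets≤ m))

pathEdges-Facets≤ : ∀ l → Facets≤ 2 (pathEdges l)
pathEdges-Facets≤ (x ∷ y ∷ l) (here refl) = ≤-refl
pathEdges-Facets≤ (x ∷ y ∷ l) (there F∈) = pathEdges-Facets≤ (y ∷ l) F∈

Δrec-Facets≤ : ∀ d Bc → (∀ n → Facets≤ (suc d) (Bc n)) → ∀ n → Facets≤ (suc d) (Δrec d Bc n)
Δrec-Facets≤ d Bc Bc≤ zero ()
Δrec-Facets≤ d Bc Bc≤ (suc n) with n <ᵇ d
... | true = λ ()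
... | false with n ≡ᵇ d
...   | true = cross-Facets≤ (suc d)
...   | false = replace-Facets≤ _ (Bc n) (suc n) (Δrec-Facets≤ d Bc Bc≤ n) (Bc≤ n)

Bjoin-Facets≤ : ∀ {d} Bp → (∀ i n → Facets≤ d (Bp i n)) → ∀ i n → Facets≤ (suc d) (Bjoin Bp i n)
Bjoin-Facets≤ Bp Bp≤ i zero ()
Bjoin-Facets≤ Bp Bp≤ zero (suc n) = coneC-Facets≤ (Bp≤ zero n)
Bjoin-Facets≤ Bp Bp≤ (suc i) (suc n) =
  ++-Facets≤ _ _ (coneC-Facets≤ (Bp≤ (suc i) n)) (coneC-Facets≤ (negC-Facets≤ (Bp≤ i n)))

LevelFacets≤ : ℕ → Level → Set
LevelFacets≤ d L = (∀ n → Facets≤ (suc d) (Level.Δl L n)) × (∀ i n → Facets≤ (suc d) (Level.Bl L i n))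

step-Facets≤ : ∀ d prev → LevelFacets≤ d prev → LevelFacets≤ (suc d) (step (suc d) prev)
step-Facets≤ d prev (Δ≤ , B≤) = Δ′≤ , B′≤
  where
  Bj≤ : ∀ i n → Facets≤ (suc (suc d)) (Bjoin (Level.Bl prev) i n)
  Bj≤ = Bjoin-Facets≤ (Level.Bl prev) B≤
  Δ′≤ : ∀ n → Facets≤ (suc (suc d)) (Level.Δl (step (suc d) prev) n)
  Δ′≤ = Δrec-Facets≤ (suc d) _ (Bj≤ _)
  B′≤ : ∀ i n → Facets≤ (suc (suc d)) (Level.Bl (step (suc d) prev) i n)
  B′≤ i n with isOdd (suc d) ∧ (i ≡ᵇ ⌈ suc d /2⌉)
  ... | true = minusC-Facets≤ _ (Bjoin (Level.Bl prev) (i ∸ 1) n) (Δ′≤ n)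
  ... | false = Bj≤ i n

level-Facets≤ : ∀ d → LevelFacets≤ d (level d)
level-Facets≤ zero = (λ n ()) , (λ i n ())
level-Facets≤ (suc zero) = (λ n → pathEdges-Facets≤ _) , B1≤
  where
  B1≤ : ∀ i n → Facets≤ 2 (B1 i n)
  B1≤ zero n (here refl) = ≤-refl
  B1≤ (suc zero) n = minusC-Facets≤ (Δ1 n) (B1 zero n) (pathEdges-Facets≤ _)
  B1≤ (suc (suc i)) n ()
level-Facets≤ (suc (suc d)) = step-Facets≤ (suc d) (level (suc d)) (level-Facets≤ (suc d))

B-Facets≤ : ∀ d i n → Facets≤ (suc d) (B d i n)
B-Facets≤ d = proj₂ (level-Facets≤ d)

B-join : ∀ d i n → ¬ T (isOdd (suc (suc d)) ∧ (i ≡ᵇ ⌈ suc (suc d) /2⌉)) →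
  B (suc (suc d)) i n ≡ Bjoin (B (suc d)) i n
B-join d i n ¬top with isOdd (suc (suc d)) ∧ (i ≡ᵇ ⌈ suc (suc d) /2⌉)
... | true = ⊥-elim (¬top tt)
... | false = refl

B-complement : ∀ d i n → T (isOdd (suc (suc d)) ∧ (i ≡ᵇ ⌈ suc (suc d) /2⌉)) →
  B (suc (suc d)) i n ≡ minusC (Δ (suc (suc d)) n) (Bjoin (B (suc d)) (i ∸ 1) n)
B-complement d i n top with isOdd (suc (suc d)) ∧ (i ≡ᵇ ⌈ suc (suc d) /2⌉)
... | true = refl

Δrec-step : ∀ d Bc n → d < n → Δrec d Bc (suc n) ≡ replace (Δrec d Bc n) (Bc n) (suc n)
Δrec-step d Bc n d<n with n <ᵇ d in n<ᵇd
... | true = ⊥-elim (<-asym d<n (<ᵇ⇒< n d (subst T (sym n<ᵇd) tt)))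
... | false with n ≡ᵇ d in n≡ᵇd
...   | true = ⊥-elim (<-irrefl (sym (≡ᵇ⇒≡ n d (subst T (sym n≡ᵇd) tt))) d<n)
...   | false = refl

-- 2k + 1 by recursion, so that ⌈_/2⌉ and isOdd compute on it
odd : ℕ → ℕ
odd zero = 1
odd (suc k) = suc (suc (odd k))

odd≡2*k+1 : ∀ k → odd k ≡ 2 * k + 1
odd≡2*k+1 zero = refl
odd≡2*k+1 (suc k) = cong suc (trans (cong suc (odd≡2*k+1 k)) (cong (_+ 1) (sym (+-suc k (k + 0)))))

⌈odd/2⌉ : ∀ k → ⌈ odd k /2⌉ ≡ suc k
⌈odd/2⌉ zero = refl
⌈odd/2⌉ (suc k) = cong suc (⌈odd/2⌉ k)

isOdd-odd : ∀ k → T (isOdd (odd k))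
isOdd-odd zero = tt
isOdd-odd (suc k) = isOdd-odd k

isOdd-even : ∀ k → ¬ T (isOdd (suc (odd k)))
isOdd-even zero ()
isOdd-even (suc k) = isOdd-even k

B-even : ∀ k i n → B (suc (odd k)) i n ≡ Bjoin (B (odd k)) i n
B-even zero i n = refl
B-even (suc k) i n = B-join (suc (odd k)) i n (isOdd-even (suc k) ∘ proj₁ ∘ Equivalence.to T-∧)

B-odd : ∀ k i n → i ≤ suc k → B (odd (suc k)) i n ≡ Bjoin (B (suc (odd k))) i n
B-odd k i n i≤1+k = B-join (odd k) i n λ top →
  <-irrefl (trans (≡ᵇ⇒≡ i _ (proj₂ (Equivalence.to T-∧ top))) (cong suc (⌈odd/2⌉ k))) (s≤s i≤1+k)

B-odd-top : ∀ k n →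
  B (odd (suc k)) (suc (suc k)) n ≡ minusC (Δ (odd (suc k)) n) (Bjoin (B (suc (odd k))) (suc k) n)
B-odd-top k n = B-complement (odd k) (suc (suc k)) n
  (Equivalence.from T-∧ (isOdd-odd (suc k) , ≡⇒≡ᵇ (suc (suc k)) _ (cong suc (sym (⌈odd/2⌉ k)))))

Δ-odd-step : ∀ k N → odd (suc k) < N →
  Δ (odd (suc k)) (suc N) ≡ replace (Δ (odd (suc k)) N) (Bjoin (B (suc (odd k))) (suc k) N) (suc N)
Δ-odd-step k N odd<N =
  subst (λ j → Δ (odd (suc k)) (suc N) ≡ replace (Δ (odd (suc k)) N) (Bjoin (B (suc (odd k))) j N) (suc N))
    (⌈odd/2⌉ k) (Δrec-step (odd (suc k)) _ N odd<N)

B-odd-complement : ∀ k n {G} → G ∈ Δ (odd k) n → ¬ IsFace (B (odd k) k n) G → G ∈ B (odd k) (suc k) n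
B-odd-complement zero n G∈Δ G∉B = minusC⁺ {Δ1 n} {B1 zero n} G∈Δ G∉B
B-odd-complement (suc k) n {G} G∈Δ G∉B = subst (G ∈_) (sym (B-odd-top k n))
  (minusC⁺ G∈Δ (subst (λ C → ¬ IsFace C G) (B-odd k (suc k) n ≤-refl) G∉B))

IsFace-⊆ : ∀ {C σ τ} → σ ⊆ τ → IsFace C τ → IsFace C σ
IsFace-⊆ σ⊆τ = Any.map λ τ⊆H {x} x∈σ → τ⊆H (σ⊆τ x∈σ)

¬IsFace-by-size : ∀ {σ C m} → Unique σ → length σ ≡ m → Facets≤ m C →
  (∀ {H} → H ∈ C → Σ ℤ λ v → v ∈ H × v ∉ σ) → ¬ IsFace C σ
¬IsFace-by-size u σ≡m C≤ escape σ∈C with find σ∈C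
... | H , H∈C , σ⊆H with escape H∈C
...   | v , v∈H , v∉σ = v∉σ (⊆-by-length u σ⊆H (subst (_ ≤_) (sym σ≡m) (C≤ H∈C)) v∈H)

¬IsFace±-by-size : ∀ {σ C m} → Unique σ → length σ ≡ m → Facets≤ m C →
  (∀ {H} → H ∈ C → Σ ℤ λ v → v ∈ H × v ∉ σ × - v ∉ σ) →
  ¬ IsFace C σ × ¬ IsFace (negC C) σ
¬IsFace±-by-size {σ} u σ≡m C≤ escape =
  ¬IsFace-by-size u σ≡m C≤ (λ H∈C → let v , v∈H , v∉σ , _ = escape H∈C in v , v∈H , v∉σ) ,
  ¬IsFace-by-size u σ≡m (negC-Facets≤ C≤) escape-neg
  where
  escape-neg : ∀ {H} → H ∈ negC _ → Σ ℤ λ v → v ∈ H × v ∉ σ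
  escape-neg -H∈ with ∈-map⁻ neg -H∈
  ... | H , H∈C , refl = let v , v∈H , _ , -v∉σ = escape H∈C in - v , ∈-neg⁺ v∈H , -v∉σ

Within : ℕ → Face → Set
Within b F = ∀ {v} → v ∈ F → Σ ℕ λ m → v ≡ pv m × 1 ≤ m × m ≤ b

Within-nv∉ : ∀ {b F} m → Within b F → nv m ∉ F
Within-nv∉ m w -m∈F with w -m∈F
Within-nv∉ zero w -m∈F | .0 , refl , () , _
Within-nv∉ (suc m) w -m∈F | _ , () , _

Within-pv∉ : ∀ {b F m} → Within b F → b < m → pv m ∉ F
Within-pv∉ w b<m m∈F with w m∈F
... | _ , refl , _ , m≤b = <-irrefl refl (≤-trans b<m m≤b)

Within-mono : ∀ {b b′ F} → Within b F → b ≤ b′ → Within b′ F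
Within-mono w b≤b′ v∈F = let m , v≡m , 1≤m , m≤b = w v∈F in m , v≡m , 1≤m , ≤-trans m≤b b≤b′

Within-cone : ∀ {b F m} → Within b F → b < m → Within m (pv m ∷ F)
Within-cone w b<m (here refl) = _ , refl , ≤-trans (s≤s z≤n) b<m , ≤-refl
Within-cone w b<m (there v∈F) = Within-mono w (<⇒≤ b<m) v∈F

Unique-cone : ∀ {b F m} → Within b F → b < m → Unique F → Unique (pv m ∷ F)
Unique-cone w b<m u = All.tabulate (λ { v∈F refl → Within-pv∉ w b<m v∈F }) AllPairs.∷ u

-- B^{1,0}_{n+1} is the edge {−1, n + 1}, so for k = 0 the vertex n + 1 is allowed in r.
r∉B-lower : ∀ k n {r} → Unique r → length r ≡ suc (odd k) → Within (suc n) r →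
  (∀ {k′} → k ≡ suc k′ → pv (suc n) ∉ r) → ¬ IsFace (B (odd k) k (suc n)) r
r∉B-lower zero n u len w _ =
  ¬IsFace-by-size u len (B-Facets≤ 1 0 (suc n)) λ { (here refl) → nv 1 , here refl , Within-nv∉ 1 w }
r∉B-lower (suc k) n {r} u len w below = ¬IsFace-by-size u len (B-Facets≤ (odd (suc k)) (suc k) (suc n)) escape
  where
  escape : ∀ {H} → H ∈ B (odd (suc k)) (suc k) (suc n) → Σ ℤ λ v → v ∈ H × v ∉ r
  escape {H} H∈ with Bjoin-apex (B (suc (odd k))) (suc k) n (subst (H ∈_) (B-odd k (suc k) (suc n) ≤-refl) H∈)
  ... | inj₁ n∈H = pv (suc n) , n∈H , below refl
  ... | inj₂ -n∈H = nv (suc n) , -n∈H , Within-nv∉ (suc n) w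

module _ (k n : ℕ) {r : Face} (r-unique : Unique r) (r-length : length r ≡ suc (odd k))
         (r-within : Within (suc n) r) (r-below : ∀ {k′} → k ≡ suc k′ → pv (suc n) ∉ r)
         (odd<n : odd k < suc n) (r∈Δ : IsFace (Δ (odd k) (suc n)) r) where

  -- B^{2k+3,k+1}_N, the ball replaced in passing from Δ^{2k+3}_N to Δ^{2k+3}_{N+1}
  ball : ℕ → Cx
  ball = Bjoin (B (suc (odd k))) (suc k)

  R target : Face
  R = pv (2 + n) ∷ r
  target = pv (4 + n) ∷ R

  R-within : Within (2 + n) R
  R-within = Within-cone r-within ≤-refl

  target-within : Within (4 + n) target
  target-within = Within-cone R-within (n≤1+n _)

  R-unique : Unique R
  R-unique = Unique-cone r-within ≤-refl r-unique

  target-unique : Unique target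
  target-unique = Unique-cone R-within (n≤1+n _) R-unique

  R-length : length R ≡ suc (suc (odd k))
  R-length = cong suc r-length

  target-length : length target ≡ suc (odd (suc k))
  target-length = cong (suc ∘ suc) r-length

  3+n∉target : pv (3 + n) ∉ target
  3+n∉target (here e) = <-irrefl (+-injective e) ≤-refl
  3+n∉target (there (here e)) = <-irrefl (sym (+-injective e)) ≤-refl
  3+n∉target (there (there 3+n∈r)) = Within-pv∉ r-within (s≤s (n≤1+n _)) 3+n∈r

  R∉-B-lower : ¬ IsFace (negC (B (suc (odd k)) k (2 + n))) R
  R∉-B-lower = ¬IsFace-by-size R-unique R-length (negC-Facets≤ (B-Facets≤ (suc (odd k)) k (2 + n))) escape
    where
    escape : ∀ {H} → H ∈ negC (B (suc (odd k)) k (2 + n)) → Σ ℤ λ v → v ∈ H × v ∉ R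
    escape -H∈ with ∈-map⁻ neg -H∈
    ... | H , H∈ , refl with Bjoin-facet (B (odd k)) k (suc n) (subst (H ∈_) (B-even k k (2 + n)) H∈)
    ...   | inj₁ (_ , _ , refl) = nv (2 + n) , here refl , Within-nv∉ (2 + n) R-within
    ...   | inj₂ (k′ , refl , K , K∈ , refl)
            with Bjoin-apex (B (suc (odd k′))) k′ n (subst (K ∈_) (B-odd k′ k′ (suc n) (n≤1+n k′)) K∈)
    ...     | inj₁ 1+n∈K = pv (suc n) , there (∈-neg⁺ (∈-neg⁺ 1+n∈K)) , 1+n∉R
      where
      1+n∉R : pv (suc n) ∉ R
      1+n∉R (here e) = <-irrefl (+-injective e) ≤-refl
      1+n∉R (there 1+n∈r) = r-below refl 1+n∈r
    ...     | inj₂ -1-n∈K = nv (suc n) , there (∈-neg⁺ (∈-neg⁺ -1-n∈K)) , Within-nv∉ (suc n) R-within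

  G : Face
  G = proj₁ (find r∈Δ)

  r⊆G : r ⊆ G
  r⊆G = proj₂ (proj₂ (find r∈Δ))

  coned : Face
  coned = pv (3 + n) ∷ pv (2 + n) ∷ G

  coned∈ball : coned ∈ ball (3 + n)
  coned∈ball = Bjoin-cone⁺ (B (suc (odd k))) (suc k) (2 + n)
    (subst (pv (2 + n) ∷ G ∈_) (sym (B-even k (suc k) (2 + n)))
      (Bjoin-cone⁺ (B (odd k)) (suc k) (suc n) G∈B-upper))
    where
    G∈B-upper : G ∈ B (odd k) (suc k) (suc n)
    G∈B-upper = B-odd-complement k (suc n) (proj₁ (proj₂ (find r∈Δ)))
      (r∉B-lower k n r-unique r-length r-within r-below ∘ IsFace-⊆ r⊆G)

  ridge : Face
  ridge = removeV (pv (3 + n)) coned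

  3+n∉R : pv (3 + n) ∉ R
  3+n∉R = Within-pv∉ R-within ≤-refl

  R⊆ridge : R ⊆ ridge
  R⊆ridge (here refl) = removeV⁺ (pv (3 + n)) coned (there (here refl)) λ e → <-irrefl (+-injective e) ≤-refl
  R⊆ridge (there x∈r) =
    removeV⁺ (pv (3 + n)) coned (there (there (r⊆G x∈r))) λ { refl → 3+n∉R (there x∈r) }

  ridge-unique : T (uniqueFacet ridge (ball (3 + n)))
  ridge-unique =
    uniqueFacet⁺ ridge (ball (3 + n)) (pv (3 + n) ∷ R) (lose coned∈ball (removeV⁻ (pv (3 + n)) coned)) only
    where
    only : ∀ {H} → H ∈ ball (3 + n) → ridge ⊆ H → H ⊆ pv (3 + n) ∷ R × pv (3 + n) ∷ R ⊆ H
    only H∈ ridge⊆H with Bjoin-facet (B (suc (odd k))) (suc k) (2 + n) H∈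
    ... | inj₁ (H′ , H′∈ , refl) = ∷⁺ʳ _ H′⊆R , ∷⁺ʳ _ R⊆H′
      where
      R⊆H′ : R ⊆ H′
      R⊆H′ = ⊆∷∧∉⇒⊆ (⊆-trans R⊆ridge ridge⊆H) 3+n∉R
      H′⊆R : H′ ⊆ R
      H′⊆R = ⊆-by-length R-unique R⊆H′
        (subst (length H′ ≤_) (sym R-length) (B-Facets≤ (suc (odd k)) (suc k) (2 + n) H′∈))
    ... | inj₂ (_ , refl , H′ , H′∈ , refl) = ⊥-elim (R∉-B-lower (lose (∈-map⁺ neg H′∈) R⊆-H′))
      where
      R⊆-H′ : R ⊆ neg H′
      R⊆-H′ = ⊆∷∧∉⇒⊆ (⊆-trans R⊆ridge ridge⊆H) (Within-nv∉ (3 + n) R-within)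

  target-face : IsFace (Δ (odd (suc k)) (4 + n)) target
  target-face = lose
    (subst (pv (4 + n) ∷ ridge ∈_) (sym (Δ-odd-step k (3 + n) (s≤s (s≤s odd<n))))
      (replace-cones {Δ (odd (suc k)) (3 + n)} {ball (3 + n)}
        (bdC⁺ {ball (3 + n)} (ridges⁺ coned∈ball (here refl)) ridge-unique)))
    (∷⁺ʳ _ R⊆ridge)

  ±-escape : ∀ {m H} → pv (suc m) ∉ target → pv (suc m) ∈ H ⊎ nv (suc m) ∈ H →
    Σ ℤ λ v → v ∈ H × v ∉ target × - v ∉ target
  ±-escape m∉ (inj₁ m∈H) = _ , m∈H , m∉ , Within-nv∉ _ target-within
  ±-escape m∉ (inj₂ -m∈H) = _ , -m∈H , Within-nv∉ _ target-within , m∉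

  3+n∈B : ∀ {i H} → H ∈ B (suc (odd k)) i (3 + n) → pv (3 + n) ∈ H ⊎ nv (3 + n) ∈ H
  3+n∈B {i} {H} H∈ = Bjoin-apex (B (odd k)) i (2 + n) (subst (H ∈_) (B-even k i (3 + n)) H∈)

  ball-escapes : ∀ {N} → 4 + n ≤ N →
    ∀ {H} → H ∈ ball N → Σ ℤ λ v → v ∈ H × v ∉ target × - v ∉ target
  ball-escapes {suc N} 4+n≤ H∈ with m≤n⇒m<n∨m≡n 4+n≤
  ... | inj₁ 4+n<N = ±-escape (Within-pv∉ target-within 4+n<N) (Bjoin-apex (B (suc (odd k))) (suc k) N H∈)
  ... | inj₂ refl with Bjoin-facet (B (suc (odd k))) (suc k) (3 + n) H∈
  ...   | inj₁ (H′ , H′∈ , refl) =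
          let v , v∈H′ , v∉ , -v∉ = ±-escape 3+n∉target (3+n∈B H′∈)
          in v , there v∈H′ , v∉ , -v∉
  ...   | inj₂ (_ , refl , H′ , H′∈ , refl) =
          let v , v∈H′ , v∉ , -v∉ = ±-escape 3+n∉target (3+n∈B H′∈)
          in - v , there (∈-neg⁺ v∈H′) , -v∉ , v∉ ∘ subst (_∈ target) (neg-involutive v)

  target∉ball : ∀ {N} → 4 + n ≤ N → ¬ IsFace (ball N) target × ¬ IsFace (negC (ball N)) target
  target∉ball {N} 4+n≤N = ¬IsFace±-by-size target-unique target-length
    (Bjoin-Facets≤ (B (suc (odd k))) (B-Facets≤ (suc (odd k))) (suc k) N) (ball-escapes 4+n≤N)

  target-face-from : ∀ {N} → 4 + n ≤′ N → IsFace (Δ (odd (suc k)) N) target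
  target-face-from ≤′-refl = target-face
  target-face-from (≤′-step {N} 4+n≤′N)
    with find (target-face-from 4+n≤′N) | target∉ball (≤′⇒≤ 4+n≤′N)
  ... | G′ , G′∈Δ , target⊆G′ | ∉ball , ∉-ball = lose
    (subst (G′ ∈_) (sym (Δ-odd-step k N odd<N))
      (replace-keeps G′∈Δ (∉ball ∘ IsFace-⊆ target⊆G′) (∉-ball ∘ IsFace-⊆ target⊆G′)))
    target⊆G′
    where
    odd<N : odd (suc k) < N
    odd<N = ≤-trans (s≤s (s≤s odd<n)) (≤-trans (n≤1+n _) (≤′⇒≤ 4+n≤′N))

-- The faces {1, 2} ∪ ⋃ {2j + 1, 2j + 3}

Sparse : List ℕ → Set
Sparse [] = ⊤
Sparse (i ∷ []) = 1 ≤ i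
Sparse (i ∷ j ∷ js) = 2 + j ≤ i × Sparse (j ∷ js)

Sparse-tail : ∀ i js → Sparse (i ∷ js) → Sparse js
Sparse-tail i [] _ = tt
Sparse-tail i (j ∷ js) (_ , sp) = sp

Sparse-length : ∀ i js → Sparse (i ∷ js) → length js < i
Sparse-length i [] 1≤i = 1≤i
Sparse-length i (j ∷ js) (2+j≤i , sp) = ≤-trans (s≤s (Sparse-length j js sp)) (≤-trans (n≤1+n _) 2+j≤i)

pairFace : List ℕ → Face
pairFace [] = pv 1 ∷ pv 2 ∷ []
pairFace (i ∷ js) = pv (2 + odd i) ∷ pv (odd i) ∷ pairFace js

maxVertex : List ℕ → ℕ
maxVertex [] = 2
maxVertex (i ∷ js) = 2 + odd i

odd-mono : ∀ {a b} → a ≤ b → odd a ≤ odd b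
odd-mono {zero} {zero} _ = ≤-refl
odd-mono {zero} {suc b} _ = s≤s z≤n
odd-mono {suc a} {suc b} (s≤s a≤b) = s≤s (s≤s (odd-mono a≤b))

odd-injective : ∀ {a b} → odd a ≡ odd b → a ≡ b
odd-injective {zero} {zero} _ = refl
odd-injective {suc a} {suc b} e = cong suc (odd-injective (suc-injective (suc-injective e)))

maxVertex-gap : ∀ i j js → Sparse (i ∷ j ∷ js) → 2 + maxVertex (j ∷ js) ≤ odd i
maxVertex-gap i j js (2+j≤i , _) = odd-mono 2+j≤i

maxVertex< : ∀ i js → Sparse (i ∷ js) → maxVertex js < odd i
maxVertex< i [] 1≤i = odd-mono 1≤i
maxVertex< i (j ∷ js) sp = ≤-trans (n≤1+n _) (maxVertex-gap i j js sp)

pairFace-within : ∀ js → Sparse js → Within (maxVertex js) (pairFace js)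
pairFace-within [] _ (here refl) = 1 , refl , ≤-refl , n≤1+n 1
pairFace-within [] _ (there (here refl)) = 2 , refl , s≤s z≤n , ≤-refl
pairFace-within (i ∷ js) sp =
  Within-cone (Within-cone (pairFace-within js (Sparse-tail i js sp)) (maxVertex< i js sp)) (n≤1+n _)

pairFace-length : ∀ js → length (pairFace js) ≡ suc (odd (length js))
pairFace-length [] = refl
pairFace-length (i ∷ js) = cong (suc ∘ suc) (pairFace-length js)

pairFace-unique : ∀ js → Sparse js → Unique (pairFace js)
pairFace-unique [] _ = ((λ ()) All.∷ All.[]) AllPairs.∷ (All.[] AllPairs.∷ AllPairs.[])
pairFace-unique (i ∷ js) sp =
  Unique-cone (Within-cone within (maxVertex< i js sp)) (n≤1+n _)
    (Unique-cone within (maxVertex< i js sp) (pairFace-unique js (Sparse-tail i js sp)))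
  where
  within : Within (maxVertex js) (pairFace js)
  within = pairFace-within js (Sparse-tail i js sp)

pairFace-below : ∀ i js → Sparse (suc i ∷ js) →
  ∀ {k′} → length js ≡ suc k′ → pv (suc (odd i)) ∉ pairFace js
pairFace-below i (j ∷ js) sp _ =
  Within-pv∉ (pairFace-within (j ∷ js) (proj₂ sp)) (s≤s (≤-pred (≤-pred (maxVertex-gap (suc i) j js sp))))

pairFace-face : ∀ js → Sparse js →
  ∀ {N} → maxVertex js ≤ N → IsFace (Δ (odd (length js)) N) (pairFace js)
pairFace-face [] _ {suc (suc N)} _ = here λ x∈ → x∈
pairFace-face [] _ {suc zero} (s≤s ())
pairFace-face (zero ∷ js) sp with () ← Sparse-length zero js sp
pairFace-face (suc i ∷ js) sp maxVertex≤N =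
  target-face-from (length js) (odd i) (pairFace-unique js sp′) (pairFace-length js)
    (Within-mono (pairFace-within js sp′) maxVertex≤) (pairFace-below i js sp)
    (s≤s (odd-mono (≤-pred (Sparse-length (suc i) js sp))))
    (pairFace-face js sp′ maxVertex≤) (≤⇒≤′ maxVertex≤N)
  where
  sp′ : Sparse js
  sp′ = Sparse-tail (suc i) js sp
  maxVertex≤ : maxVertex js ≤ suc (odd i)
  maxVertex≤ = ≤-pred (maxVertex< (suc i) js sp)

-- The embedding j ↦ 2(n − j) + 3

vertexMap : ℕ → ℕ → ℤ
vertexMap n j = pv (2 + odd (n ∸ j))

∸-suc : ∀ {n i} → i < n → n ∸ i ≡ suc (n ∸ suc i)
∸-suc {suc n} {zero} _ = refl
∸-suc {suc n} {suc i} (s≤s i<n) = ∸-suc i<n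

Adm-mono : ∀ {lo m n} → m ≤ n → ∀ is → Adm lo m is → Adm lo n is
Adm-mono m≤n [] adm = adm
Adm-mono m≤n (i ∷ is) (lo≤i , i<m , adm) = lo≤i , ≤-trans i<m m≤n , Adm-mono m≤n is adm

Adm⇒Sparse : ∀ {lo n} is → Adm lo n is → Sparse (map (n ∸_) is)
Adm⇒Sparse [] _ = tt
Adm⇒Sparse (i ∷ []) (_ , i<n , _) = m<n⇒0<n∸m i<n
Adm⇒Sparse (i ∷ i′ ∷ is) (_ , i<n , adm@(2+i≤i′ , i′<n , _)) =
  ≤-trans (s≤s (∸-monoʳ-< 2+i≤i′ (<⇒≤ i′<n))) (∸-monoʳ-< ≤-refl i<n) ,
  Adm⇒Sparse (i′ ∷ is) adm

pairs-bounded : ∀ {lo n} is → Adm lo n is → ∀ {j} → j ∈ pairs is → j ≤ n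
pairs-bounded (i ∷ is) (_ , i<n , _) (here refl) = <⇒≤ i<n
pairs-bounded (i ∷ is) (_ , i<n , _) (there (here refl)) = i<n
pairs-bounded (i ∷ is) (_ , _ , adm) (there (there j∈)) = pairs-bounded is adm j∈

vertexMap-pairs : ∀ {lo n} is → Adm lo n is →
  ∀ {j} → j ∈ pairs is → vertexMap n j ∈ pairFace (map (n ∸_) is)
vertexMap-pairs (i ∷ is) _ (here refl) = here refl
vertexMap-pairs (i ∷ is) (_ , i<n , _) (there (here refl)) =
  there (here (cong (pv ∘ odd) (sym (∸-suc i<n))))
vertexMap-pairs (i ∷ is) (_ , _ , adm) (there (there j∈)) = there (there (vertexMap-pairs is adm j∈))

vertexMap-injective : ∀ {n x y} → x ≤ n → y ≤ n → vertexMap n x ≡ vertexMap n y → x ≡ y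
vertexMap-injective x≤n y≤n e =
  ∸-cancelˡ-≡ x≤n y≤n (odd-injective (suc-injective (suc-injective (+-injective e))))

vertexMap∉12 : ∀ {n j} → vertexMap n j ∉ pv 1 ∷ pv 2 ∷ []
vertexMap∉12 (here ())
vertexMap∉12 {n} {j} (there (here e)) with n ∸ j
... | zero with () ← e
... | suc _ with () ← e

12⊆pairFace : ∀ js → pv 1 ∷ pv 2 ∷ [] ⊆ pairFace js
12⊆pairFace [] 12∈ = 12∈
12⊆pairFace (i ∷ js) 12∈ = there (there (12⊆pairFace js 12∈))

maxVertex-Adm : ∀ {n} → 1 ≤ n → ∀ is → Adm 1 n is → maxVertex (map (n ∸_) is) ≤ odd n
maxVertex-Adm 1≤n [] _ = <⇒≤ (odd-mono 1≤n)
maxVertex-Adm 1≤n (i ∷ is) (1≤i , i<n , _) = odd-mono (∸-monoʳ-< 1≤i (<⇒≤ i<n))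

InF-vertex≤ : ∀ {k n x} → Gen (InF k n) (x ∷ []) → x ≤ n
InF-vertex≤ (_ , (is , _ , adm , refl) , x∈) = pairs-bounded is adm (x∈ (here refl))

InF-mono : ∀ {k m n} → m ≤ n → ∀ σ → InF k m σ → InF k n σ
InF-mono m≤n σ (is , length≡k , adm , σ≡) = is , length≡k , Adm-mono m≤n is adm , σ≡

pairComplex-in-Λ : ∀ k n → 1 ≤ n → ∀ σ → Gen (InF k n) σ → Λ k n (map (vertexMap n) σ)
pairComplex-in-Λ k n 1≤n σ (_ , (is , length≡k , adm , refl) , σ⊆τ) = avoids12 , IsFace-⊆ ⊆pairFace face
  where
  js : List ℕ
  js = map (n ∸_) is
  avoids12 : ∀ {v} → v ∈ map (vertexMap n) σ → v ∉ pv 1 ∷ pv 2 ∷ []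
  avoids12 v∈ with ∈-map⁻ (vertexMap n) v∈
  ... | j , _ , refl = vertexMap∉12 {n} {j}
  ⊆pairFace : map (vertexMap n) σ ++ pv 1 ∷ pv 2 ∷ [] ⊆ pairFace js
  ⊆pairFace v∈ with ∈-++⁻ (map (vertexMap n) σ) v∈
  ... | inj₂ v∈12 = 12⊆pairFace js v∈12
  ... | inj₁ v∈σ with ∈-map⁻ (vertexMap n) v∈σ
  ...   | j , j∈σ , refl = vertexMap-pairs is adm (σ⊆τ j∈σ)
  face : IsFace (Δ (2 * k + 1) (2 * n + 1)) (pairFace js)
  face = subst₂ (λ d N → IsFace (Δ d N) (pairFace js))
    (trans (cong odd (trans (length-map (n ∸_) is) length≡k)) (odd≡2*k+1 k)) (odd≡2*k+1 n)
    (pairFace-face js (Adm⇒Sparse is adm) (maxVertex-Adm 1≤n is adm))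

pairComplex-embeds : ∀ k n → 1 ≤ n → IsoSub (Gen (InF k n)) (Λ k n)
pairComplex-embeds k n 1≤n =
  vertexMap n ,
  (λ x y x∈ y∈ → vertexMap-injective (InF-vertex≤ x∈) (InF-vertex≤ y∈)) ,
  pairComplex-in-Λ k n 1≤n

Gen-mono : ∀ {P Q} → (∀ σ → P σ → Q σ) → ∀ σ → Gen P σ → Gen Q σ
Gen-mono P⊆Q σ (τ , Pτ , σ⊆τ) = τ , P⊆Q τ Pτ , σ⊆τ

IsoSub-mono : ∀ {A A′ K K′} →
  (∀ σ → A σ → A′ σ) → (∀ σ → K σ → K′ σ) → IsoSub A′ K → IsoSub A K′
IsoSub-mono A⊆A′ K⊆K′ (f , injective , faces) =
  f ,
  (λ x y x∈ y∈ → injective x y (A⊆A′ _ x∈) (A⊆A′ _ y∈)) ,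
  (λ σ σ∈ → K⊆K′ _ (faces σ (A⊆A′ σ σ∈)))

Lk⊆ : ∀ {τ C σ} → Lk τ (IsFace C) σ → IsFace C σ
Lk⊆ (_ , σ∪τ∈C) = IsFace-⊆ ∈-++⁺ˡ σ∪τ∈C

proposition4p3 : (k n : ℕ) → 1 ≤ k → k + 1 ≤ n →
    IsoSub (Gen (InF k n)) (Λ k n) ×
    ((m : ℕ) → m ≤ n → (P : List ℕ → Set) → NonemptyInitial k m P →
      IsoSub (Gen P) (Λ k n)) ×
    ((m : ℕ) → m ≤ n → (P : List ℕ → Set) → NonemptyInitial k m P →
      IsoSub (Gen P) (IsFace (Δ (2 * k + 1) (2 * n + 1))))
proposition4p3 k n _ k+1≤n = F-embeds , squeezed-embeds , λ m m≤n P P-init →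
  IsoSub-mono {K = Λ k n} (λ _ σ∈ → σ∈) (λ _ → Lk⊆) (squeezed-embeds m m≤n P P-init)
  where
  F-embeds : IsoSub (Gen (InF k n)) (Λ k n)
  F-embeds = pairComplex-embeds k n (≤-trans (m≤n+m 1 k) k+1≤n)
  squeezed-embeds : (m : ℕ) → m ≤ n → (P : List ℕ → Set) → NonemptyInitial k m P →
    IsoSub (Gen P) (Λ k n)
  squeezed-embeds m m≤n P (_ , P⊆F , _) =
    IsoSub-mono {K = Λ k n} (Gen-mono λ σ Pσ → InF-mono m≤n σ (P⊆F σ Pσ)) (λ _ σ∈ → σ∈) F-embeds
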